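{- Let $k$ be an odd prime, and let $S\subseteq\{0,1\}^k$ be an independent set in the simple graph underlying $B(k,2)$ such that \[ |S|=1+\frac{k-1}{2k}(2^k-2) \] and such that $S$ contains exactly one of the two constant words $0^k,1^k$. Then for every non-trivial rotation orbit $C$ one has $|S\cap C|=\frac{k-1}2$, and there exists a unique phase $t_C\in\mathbb Z/k\mathbb Z$ such that $S\cap C=A_{t_C}(C)$.
   Context: Words are written $x=x_0x_1\dots x_{k-1}\in\{0,1\}^k$. The simple graph underlying $B(k,2)$ has vertex set $\{0,1\}^k$, and distinct words $x,y$ are adjacent iff $x_1\dots x_{k-1}=y_0\dots y_{k-2}$ or $y_1\dots y_{k-1}=x_0\dots x_{k-2}$. Let $\rho(x_0x_1\dots x_{k-1}):=x_1\dots x_{k-1}x_0$ be the cyclic rotation. A non-trivial rotation orbit is an orbit $C=\{\rho^i(x):i\in\mathbb Z/k\mathbb Z\}$ of a non-constant word; for each such orbit fix a representative $x\in C$ and write $x^{(i)}:=\rho^i(x)$, $i\in\mathbb Z/k\mathbb Z$ (for non-constant $x$ and prime $k$ these are $k$ distinct words). Let $J_k:=\{1,3,5,\dots,k-2\}\subseteq\mathbb Z/k\mathbb Z$ and, for $t\in\mathbb Z/k\mathbb Z$, $A_t(C):=\{x^{(t+r)}:r\in J_k\}$. -}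

module Defs where

open import Data.Nat using (ℕ; zero; suc; _+_; _*_; _∸_; _≤_)
open import Data.Bool using (Bool; true; false; _∧_; if_then_else_)
open import Data.Vec using (Vec; []; _∷_; _∷ʳ_; replicate)
import Data.Vec.Properties as VP
open import Data.Bool.Properties using () renaming (_≟_ to _≟ᵇ_)
open import Data.List using (List; []; _∷_; _++_; map; upTo)
open import Data.Bool.ListAction using (any)
open import Data.Product using (Σ; _×_)
open import Data.Sum using (_⊎_)
open import Relation.Binary.PropositionalEquality using (_≡_; _≢_)
open import Relation.Nullary using (¬_; does)

Word : ℕ → Set
Word k = Vec Bool k

suffix : ∀ {k} → Word k → Word (Data.Nat.pred k)
suffix [] = []
suffix (x ∷ xs) = xs

prefix : ∀ {k} → Word k → Word (Data.Nat.pred k)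
prefix [] = []
prefix (x ∷ []) = []
prefix (x ∷ y ∷ ys) = x ∷ prefix (y ∷ ys)

-- adjacency in the simple graph underlying B(k,2)
Adj : ∀ {k} → Word k → Word k → Set
Adj x y = x ≢ y × (suffix x ≡ prefix y ⊎ suffix y ≡ prefix x)

Independent : ∀ {k} → (Word k → Bool) → Set
Independent {k} S = (x y : Word k) → S x ≡ true → S y ≡ true → ¬ Adj x y

allWords : (k : ℕ) → List (Word k)
allWords zero = [] ∷ []
allWords (suc k) = map (false ∷_) (allWords k) ++ map (true ∷_) (allWords k)

countᵇ : ∀ {a} {A : Set a} → (A → Bool) → List A → ℕ
countᵇ p [] = 0
countᵇ p (x ∷ xs) = if p x then suc (countᵇ p xs) else countᵇ p xs

card : ∀ {k} → (Word k → Bool) → ℕ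
card {k} S = countᵇ S (allWords k)

ρ : ∀ {k} → Word k → Word k
ρ [] = []
ρ (x ∷ xs) = xs ∷ʳ x

ρ^ : ∀ {k} → ℕ → Word k → Word k
ρ^ zero x = x
ρ^ (suc i) x = ρ (ρ^ i x)

_≟w_ : ∀ {k} → (x y : Word k) → Relation.Nullary.Dec (x ≡ y)
_≟w_ = VP.≡-dec _≟ᵇ_

inOrbitᵇ : ∀ {k} → Word k → Word k → Bool
inOrbitᵇ {k} x y = any (λ i → does (ρ^ i x ≟w y)) (upTo k)

InOrbit : ∀ {k} → Word k → Word k → Set
InOrbit {k} x y = Σ ℕ λ i → i Data.Nat.< k × ρ^ i x ≡ y

cardInOrbit : ∀ {k} → (Word k → Bool) → Word k → ℕ
cardInOrbit {k} S x = countᵇ (λ y → S y ∧ inOrbitᵇ x y) (allWords k)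

constW : ∀ k → Bool → Word k
constW k b = replicate k b

NonConstant : ∀ {k} → Word k → Set
NonConstant {k} x = x ≢ constW k false × x ≢ constW k true

J : ℕ → ℕ → Set
J k r = Σ ℕ λ j → r ≡ suc (2 * j) × r ≤ k ∸ 2

-- y ∈ A_t(C), where C is the orbit of the representative x and t ∈ ℤ/kℤ
-- is given by a number t < k (ρ^k = id, so exponents need not be reduced)
InA : ∀ {k} → Word k → ℕ → Word k → Set
InA {k} x t y = Σ ℕ λ r → J k r × y ≡ ρ^ (t + r) x

module Submission where

-- For a non-constant word x, ρ^i x and ρ^(i+1) x are distinct and adjacent, so b i = [ρ^i x ∈ S]
-- is a k-periodic 0/1 sequence without two adjacent ones; for k = 2m + 1 a period holds at most
-- m ones, and for prime k their number is |S ∩ C|. Summing the number of ones over all words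
-- counts every element of S exactly k times, so
--   k |S| ≤ k ([0^k ∈ S] + [1^k ∈ S]) + m (2^k - 2) = k + m (2^k - 2),
-- and the hypothesis on |S| forces every orbit to reach m. A period of such a sequence with m ones
-- contains exactly one pair of adjacent zeros; starting at the second of them it reads
-- 0 1 0 1 … 1 0, which is S ∩ C = A_t. Conversely S ∩ C = A_t′ puts adjacent zeros just before
-- t′, so t′ = t.

open import Defs
open import Data.Bool using (Bool; true; false; _∧_; T; if_then_else_)
open import Data.Bool.ListAction using (any)
open import Data.Empty using (⊥-elim)
open import Data.List as List using (List; []; _∷_; _++_; map; upTo; length)
open import Data.List.Properties using (upTo-∷ʳ; map-upTo; length-upTo; length-++; length-map; ++-assoc; ++-identityʳ)
open import Data.List.Membership.Propositional.Properties using (∈-upTo⁺; ∈-++⁺ˡ; ∈-++⁺ʳ; ∈-map⁺)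
open import Data.List.Membership.Propositional using (_∈_)
open import Data.List.Relation.Unary.Any using (here; there)
import Data.List.Relation.Unary.All as All
open All using (All; []; _∷_)
open import Data.List.Relation.Unary.AllPairs using (AllPairs; []; _∷_)
import Data.List.Relation.Unary.AllPairs.Properties as AllPairs
open import Data.Nat using (ℕ; zero; suc; _+_; _*_; _∸_; _^_; _/_; _%_; _<_; _≤_; z≤n; s≤s; z<s; NonZero; >-nonZero)
open import Data.Nat.GeneralisedArithmetic using (fold; fold-+)
open import Data.Nat.Primality using (Prime; prime⇒irreducible; ¬prime[1])
open import Data.Nat.Divisibility using (divides)
open import Data.Nat.Coprimality as Coprime using (Coprime; coprime-Bézout; prime⇒coprime)
open import Data.Nat.GCD using (module Bézout)
open import Data.Nat.Properties
open import Data.Nat.DivMod using (m≡m%n+[m/n]*n; m%n<n; m*n%n≡0; [m+kn]%n≡m%n; m*n/n≡m)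
open import Data.Nat.Tactic.RingSolver using (solve-∀)
open import Relation.Binary using (tri<; tri≈; tri>)
open import Algebra.Properties.CommutativeSemigroup +-commutativeSemigroup using (interchange; x∙yz≈xz∙y; xy∙z≈xz∙y)
open import Data.Vec using (Vec; []; _∷_; _∷ʳ_; replicate; toList)
import Data.Vec.Properties as VP
open import Data.Product using (Σ; ∃-syntax; _×_; _,_; proj₁; proj₂)
open import Data.Sum using (_⊎_; inj₁; inj₂)
open import Function using (_∘_; id)
open import Function.Bundles using (_⇔_; mk⇔; Equivalence)
open import Relation.Binary.PropositionalEquality hiding (J)
open import Relation.Nullary using (does; yes; no)
open import Relation.Nullary.Decidable using (dec-false)

private
  variable
    A B : Set

𝟙 : Bool → ℕ
𝟙 true = 1
𝟙 false = 0

𝟙-∧ : ∀ a b → 𝟙 (a ∧ b) ≡ 𝟙 a * 𝟙 b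
𝟙-∧ true b = sym (+-identityʳ (𝟙 b))
𝟙-∧ false b = refl

𝟙≡1⇒true : ∀ {a} → 𝟙 a ≡ 1 → a ≡ true
𝟙≡1⇒true {true} _ = refl

∑ : List A → (A → ℕ) → ℕ
∑ [] f = 0
∑ (x ∷ xs) f = f x + ∑ xs f

∑-++ : ∀ xs ys (f : A → ℕ) → ∑ (xs ++ ys) f ≡ ∑ xs f + ∑ ys f
∑-++ [] ys f = refl
∑-++ (x ∷ xs) ys f = trans (cong (f x +_) (∑-++ xs ys f)) (sym (+-assoc (f x) _ _))

∑-map : ∀ (g : A → B) xs (f : B → ℕ) → ∑ (map g xs) f ≡ ∑ xs (f ∘ g)
∑-map g [] f = refl
∑-map g (x ∷ xs) f = cong (f (g x) +_) (∑-map g xs f)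

∑-cong : ∀ xs {f g : A → ℕ} → (∀ x → f x ≡ g x) → ∑ xs f ≡ ∑ xs g
∑-cong [] f≗g = refl
∑-cong (x ∷ xs) f≗g = cong₂ _+_ (f≗g x) (∑-cong xs f≗g)

∑-const : ∀ (xs : List A) c → ∑ xs (λ _ → c) ≡ length xs * c
∑-const [] c = refl
∑-const (x ∷ xs) c = cong (c +_) (∑-const xs c)

∑-distrib-+ : ∀ xs (f g : A → ℕ) → ∑ xs (λ x → f x + g x) ≡ ∑ xs f + ∑ xs g
∑-distrib-+ [] f g = refl
∑-distrib-+ (x ∷ xs) f g =
  trans (cong (f x + g x +_) (∑-distrib-+ xs f g)) (interchange (f x) (g x) (∑ xs f) (∑ xs g))

*-distribˡ-∑ : ∀ c xs (f : A → ℕ) → c * ∑ xs f ≡ ∑ xs (λ x → c * f x)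
*-distribˡ-∑ c [] f = *-zeroʳ c
*-distribˡ-∑ c (x ∷ xs) f = trans (*-distribˡ-+ c (f x) (∑ xs f)) (cong (c * f x +_) (*-distribˡ-∑ c xs f))

∑-comm : ∀ xs ys (f : A → B → ℕ) → ∑ xs (λ x → ∑ ys (f x)) ≡ ∑ ys (λ y → ∑ xs (λ x → f x y))
∑-comm [] ys f = sym (trans (∑-const ys 0) (*-zeroʳ (length ys)))
∑-comm (x ∷ xs) ys f =
  trans (cong (∑ ys (f x) +_) (∑-comm xs ys f)) (sym (∑-distrib-+ ys (f x) (λ y → ∑ xs (λ x → f x y))))

∑-mono-≤ : ∀ xs {f g : A → ℕ} → (∀ x → f x ≤ g x) → ∑ xs f ≤ ∑ xs g
∑-mono-≤ [] f≤g = z≤n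
∑-mono-≤ (x ∷ xs) f≤g = +-mono-≤ (f≤g x) (∑-mono-≤ xs f≤g)

+-mono-≤-≡⇒≡ : ∀ {a b c d} → a ≤ c → b ≤ d → a + b ≡ c + d → a ≡ c × b ≡ d
+-mono-≤-≡⇒≡ {a} {b} {c} {d} a≤c b≤d eq = a≡c , +-cancelˡ-≡ c b d (trans (cong (_+ b) (sym a≡c)) eq)
  where
  a≡c : a ≡ c
  a≡c = ≤-antisym a≤c (+-cancelʳ-≤ d c a (≤-trans (≤-reflexive (sym eq)) (+-monoʳ-≤ a b≤d)))

∑-mono-≤-≡⇒≡ : ∀ {xs} {f g : A → ℕ} → (∀ x → f x ≤ g x) → ∑ xs f ≡ ∑ xs g → ∀ {x} → x ∈ xs → f x ≡ g x
∑-mono-≤-≡⇒≡ {xs = y ∷ ys} f≤g eq (here refl) = proj₁ (+-mono-≤-≡⇒≡ (f≤g y) (∑-mono-≤ ys f≤g) eq)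
∑-mono-≤-≡⇒≡ {xs = y ∷ ys} f≤g eq (there x∈ys) =
  ∑-mono-≤-≡⇒≡ f≤g (proj₂ (+-mono-≤-≡⇒≡ (f≤g y) (∑-mono-≤ ys f≤g) eq)) x∈ys

countᵇ≡∑𝟙 : ∀ (p : A → Bool) xs → countᵇ p xs ≡ ∑ xs (𝟙 ∘ p)
countᵇ≡∑𝟙 p [] = refl
countᵇ≡∑𝟙 p (x ∷ xs) with p x
... | true = cong suc (countᵇ≡∑𝟙 p xs)
... | false = countᵇ≡∑𝟙 p xs

∑-𝟙-all-false : ∀ (p : A → Bool) {xs} → All (λ x → p x ≡ false) xs → ∑ xs (𝟙 ∘ p) ≡ 0
∑-𝟙-all-false p [] = refl
∑-𝟙-all-false p (px≡false ∷ pxs) rewrite px≡false = ∑-𝟙-all-false p pxs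

𝟙-any≡∑𝟙 : ∀ (p : A → Bool) {xs} → AllPairs (λ x y → T (p x) → p y ≡ false) xs → 𝟙 (any p xs) ≡ ∑ xs (𝟙 ∘ p)
𝟙-any≡∑𝟙 p [] = refl
𝟙-any≡∑𝟙 p {x ∷ xs} (px⇒¬p ∷ pairs) with p x
... | true = cong suc (sym (∑-𝟙-all-false p (All.map (λ f → f _) px⇒¬p)))
... | false = 𝟙-any≡∑𝟙 p pairs

∑-upTo-last : ∀ n (f : ℕ → ℕ) → ∑ (upTo (suc n)) f ≡ ∑ (upTo n) f + f n
∑-upTo-last n f = begin
  ∑ (upTo (suc n)) f           ≡⟨ cong (λ xs → ∑ xs f) (sym (upTo-∷ʳ n)) ⟩
  ∑ (upTo n List.∷ʳ n) f       ≡⟨ ∑-++ (upTo n) (n ∷ []) f ⟩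
  ∑ (upTo n) f + (f n + 0)     ≡⟨ cong (∑ (upTo n) f +_) (+-identityʳ (f n)) ⟩
  ∑ (upTo n) f + f n           ∎
  where open ≡-Reasoning

∑-upTo-head : ∀ n (f : ℕ → ℕ) → ∑ (upTo (suc n)) f ≡ f 0 + ∑ (upTo n) (f ∘ suc)
∑-upTo-head n f = cong (f 0 +_) (trans (cong (λ xs → ∑ xs f) (sym (map-upTo suc n))) (∑-map suc (upTo n) f))

∑-upTo-<⇒∃≡0 : ∀ n {f : ℕ → ℕ} → (∀ i → f i ≤ 1) → ∑ (upTo n) f < n → ∃[ i ] (i < n × f i ≡ 0)
∑-upTo-<⇒∃≡0 (suc n) {f} f≤1 ∑<1+n with f n in fn≡
... | zero = n , ≤-refl , fn≡
... | suc z = let (i , i<n , fi≡0) = ∑-upTo-<⇒∃≡0 n f≤1 ∑<n in i , m<n⇒m<1+n i<n , fi≡0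
  where
  ∑<n : ∑ (upTo n) f < n
  ∑<n = m+n≤o⇒m≤o (suc (∑ (upTo n) f)) {z}
          (≤-pred (subst (_< suc n) (trans (∑-upTo-last n f) (trans (cong (∑ (upTo n) f +_) fn≡) (+-suc _ z))) ∑<1+n))

∑-upTo-1 : ∀ n → ∑ (upTo n) (λ _ → 1) ≡ n
∑-upTo-1 n = trans (∑-const (upTo n) 1) (trans (*-identityʳ _) (length-upTo n))

∑-upTo-≡n⇒≡1 : ∀ n {f : ℕ → ℕ} → (∀ i → f i ≤ 1) → ∑ (upTo n) f ≡ n → ∀ {i} → i < n → f i ≡ 1
∑-upTo-≡n⇒≡1 n f≤1 ∑≡n i<n = ∑-mono-≤-≡⇒≡ f≤1 (trans ∑≡n (sym (∑-upTo-1 n))) (∈-upTo⁺ i<n)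

Periodic : ℕ → (ℕ → A) → Set
Periodic k f = ∀ i → f (i + k) ≡ f i

periodic-shift : ∀ {k} {f : ℕ → A} → Periodic k f → ∀ t → Periodic k (λ i → f (t + i))
periodic-shift {k = k} {f} per t i = trans (cong f (sym (+-assoc t i k))) (per (t + i))

periodic-+* : ∀ {k} {f : ℕ → A} → Periodic k f → ∀ q i → f (i + q * k) ≡ f i
periodic-+* {f = f} per zero i = cong f (+-identityʳ i)
periodic-+* {k = k} {f} per (suc q) i =
  trans (cong f (x∙yz≈xz∙y i k (q * k))) (trans (per (i + q * k)) (periodic-+* per q i))

periodic-% : ∀ {k} .{{_ : NonZero k}} {f : ℕ → A} → Periodic k f → ∀ n → f (n % k) ≡ f n
periodic-% {k = k} {f} per n = trans (sym (periodic-+* per (n / k) (n % k))) (cong f (sym (m≡m%n+[m/n]*n n k)))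

∑-upTo-rotate : ∀ n {f : ℕ → ℕ} → Periodic n f → ∑ (upTo n) (f ∘ suc) ≡ ∑ (upTo n) f
∑-upTo-rotate zero per = refl
∑-upTo-rotate (suc n) {f} per = begin
  ∑ (upTo (suc n)) (f ∘ suc)        ≡⟨ ∑-upTo-last n (f ∘ suc) ⟩
  ∑ (upTo n) (f ∘ suc) + f (suc n)  ≡⟨ cong (∑ (upTo n) (f ∘ suc) +_) (per 0) ⟩
  ∑ (upTo n) (f ∘ suc) + f 0        ≡⟨ +-comm _ (f 0) ⟩
  f 0 + ∑ (upTo n) (f ∘ suc)        ≡⟨ ∑-upTo-head n f ⟨
  ∑ (upTo (suc n)) f                ∎
  where open ≡-Reasoning

∑-upTo-shift : ∀ n {f : ℕ → ℕ} → Periodic n f → ∀ t → ∑ (upTo n) (λ r → f (t + r)) ≡ ∑ (upTo n) f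
∑-upTo-shift n per zero = refl
∑-upTo-shift n {f} per (suc t) = begin
  ∑ (upTo n) (λ r → f (suc t + r))  ≡⟨ ∑-cong (upTo n) (λ r → cong f (sym (+-suc t r))) ⟩
  ∑ (upTo n) (λ r → f (t + suc r))  ≡⟨ ∑-upTo-rotate n (periodic-shift per t) ⟩
  ∑ (upTo n) (λ r → f (t + r))      ≡⟨ ∑-upTo-shift n per t ⟩
  ∑ (upTo n) f                      ∎
  where open ≡-Reasoning

r%2+[1+r]%2≡1 : ∀ r → r % 2 + suc r % 2 ≡ 1
r%2+[1+r]%2≡1 zero = refl
r%2+[1+r]%2≡1 (suc zero) = refl
r%2+[1+r]%2≡1 (suc (suc r)) = r%2+[1+r]%2≡1 r

-- 0/1 sequences of odd period without two adjacent ones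

module SparseCycle {m : ℕ} {b : ℕ → ℕ}
  (b-periodic : Periodic (suc (2 * m)) b) (b-sparse : ∀ i → b i + b (suc i) ≤ 1) where

  private
    k : ℕ
    k = suc (2 * m)

  pairSum : ℕ → ℕ
  pairSum i = b i + b (suc i)

  pairSum-periodic : Periodic k pairSum
  pairSum-periodic i = cong₂ _+_ (b-periodic i) (b-periodic (suc i))

  ∑-pairSum : ∑ (upTo k) pairSum ≡ 2 * ∑ (upTo k) b
  ∑-pairSum = begin
    ∑ (upTo k) pairSum                    ≡⟨ ∑-distrib-+ (upTo k) b (b ∘ suc) ⟩
    ∑ (upTo k) b + ∑ (upTo k) (b ∘ suc)   ≡⟨ cong (∑ (upTo k) b +_) (∑-upTo-rotate k b-periodic) ⟩
    ∑ (upTo k) b + ∑ (upTo k) b           ≡⟨ cong (∑ (upTo k) b +_) (+-identityʳ _) ⟨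
    2 * ∑ (upTo k) b                      ∎
    where open ≡-Reasoning

  ∑≤m : ∑ (upTo k) b ≤ m
  ∑≤m = ≤-pred (*-cancelˡ-< 2 _ _ (begin-strict
    2 * ∑ (upTo k) b        ≡⟨ ∑-pairSum ⟨
    ∑ (upTo k) pairSum      ≤⟨ ∑-mono-≤ (upTo k) b-sparse ⟩
    ∑ (upTo k) (λ _ → 1)    ≡⟨ ∑-upTo-1 k ⟩
    k                       <⟨ n<1+n k ⟩
    suc k                   ≡⟨ *-suc 2 m ⟨
    2 * suc m               ∎))
    where open ≤-Reasoning

  ∑-pairSum-shift : ∑ (upTo k) b ≡ m → ∀ t → ∑ (upTo k) (λ r → pairSum (t + r)) ≡ 2 * m
  ∑-pairSum-shift ∑≡m t = trans (∑-upTo-shift k pairSum-periodic t) (trans ∑-pairSum (cong (2 *_) ∑≡m))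

  AlternatesFrom : ℕ → Set
  AlternatesFrom t = ∀ r → r < k → b (t + r) ≡ r % 2

  gap⇒alternates : ∑ (upTo k) b ≡ m → ∀ {t} → pairSum (t + 2 * m) ≡ 0 → AlternatesFrom t
  gap⇒alternates ∑≡m {t} gap = alternates
    where
    ∑window : ∑ (upTo (2 * m)) (λ r → pairSum (t + r)) ≡ 2 * m
    ∑window = begin
      ∑ (upTo (2 * m)) (λ r → pairSum (t + r))                         ≡⟨ +-identityʳ _ ⟨
      ∑ (upTo (2 * m)) (λ r → pairSum (t + r)) + 0                     ≡⟨ cong (∑ (upTo (2 * m)) (λ r → pairSum (t + r)) +_) gap ⟨
      ∑ (upTo (2 * m)) (λ r → pairSum (t + r)) + pairSum (t + 2 * m)   ≡⟨ ∑-upTo-last (2 * m) _ ⟨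
      ∑ (upTo k) (λ r → pairSum (t + r))                               ≡⟨ ∑-pairSum-shift ∑≡m t ⟩
      2 * m                                                            ∎
      where open ≡-Reasoning

    window : ∀ r → r < 2 * m → pairSum (t + r) ≡ 1
    window r = ∑-upTo-≡n⇒≡1 (2 * m) (λ r → b-sparse (t + r)) ∑window

    alternates : AlternatesFrom t
    alternates zero _ = begin
      b (t + 0)              ≡⟨ cong b (+-identityʳ t) ⟩
      b t                    ≡⟨ b-periodic t ⟨
      b (t + k)              ≡⟨ cong b (+-suc t (2 * m)) ⟩
      b (suc (t + 2 * m))    ≡⟨ m+n≡0⇒n≡0 _ gap ⟩
      0                      ∎
      where open ≡-Reasoning
    alternates (suc r) (s≤s r<2m) = +-cancelˡ-≡ (r % 2) _ _ (begin
      r % 2 + b (t + suc r)          ≡⟨ cong₂ _+_ (alternates r (m<n⇒m<1+n r<2m)) (cong b (sym (+-suc t r))) ⟨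
      b (t + r) + b (suc (t + r))    ≡⟨ window r r<2m ⟩
      1                              ≡⟨ r%2+[1+r]%2≡1 r ⟨
      r % 2 + suc r % 2              ∎)
      where open ≡-Reasoning

  ∑≡m⇒alternates : ∑ (upTo k) b ≡ m → ∃[ t ] (t < k × AlternatesFrom t)
  ∑≡m⇒alternates ∑≡m
    with ∑-upTo-<⇒∃≡0 k (λ r → b-sparse (2 * m + r)) (s≤s (≤-reflexive (∑-pairSum-shift ∑≡m (2 * m))))
  ... | t , t<k , gap = t , t<k , gap⇒alternates ∑≡m (trans (cong pairSum (+-comm t (2 * m))) gap)

  alternates⇒pairSum≡1 : ∀ {t} → AlternatesFrom t → ∀ r → r < 2 * m → pairSum (t + r) ≡ 1
  alternates⇒pairSum≡1 {t} alt r r<2m = begin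
    b (t + r) + b (suc (t + r))   ≡⟨ cong₂ _+_ (alt r (m<n⇒m<1+n r<2m)) (trans (cong b (sym (+-suc t r))) (alt (suc r) (s≤s r<2m))) ⟩
    r % 2 + suc r % 2             ≡⟨ r%2+[1+r]%2≡1 r ⟩
    1                             ∎
    where open ≡-Reasoning

  pairSum≡0-unique : ∀ {t t′} → AlternatesFrom t → t < k → t′ < k → pairSum (t′ + 2 * m) ≡ 0 → t′ ≡ t
  pairSum≡0-unique {t} {t′} alt t<k t′<k gap with <-cmp t t′
  ... | tri≈ _ t≡t′ _ = sym t≡t′
  ... | tri< t<t′ _ _ with m≤n⇒∃[o]m+o≡n t<t′
  ...   | d , refl = ⊥-elim (1+n≢0 (begin
    1                              ≡⟨ alternates⇒pairSum≡1 alt d d<2m ⟨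
    pairSum (t + d)                ≡⟨ pairSum-periodic (t + d) ⟨
    pairSum (t + d + k)            ≡⟨ cong pairSum (rearrange t d (2 * m)) ⟩
    pairSum (suc t + d + 2 * m)    ≡⟨ gap ⟩
    0                              ∎))
    where
    open ≡-Reasoning
    d<2m : d < 2 * m
    d<2m = ≤-trans (s≤s (m≤n+m d t)) (≤-pred t′<k)
    rearrange : ∀ t d n → t + d + suc n ≡ suc t + d + n
    rearrange = solve-∀
  pairSum≡0-unique {t} {t′} alt t<k t′<k gap | tri> _ _ t′<t with m≤n⇒∃[o]m+o≡n t′<t
  ...   | d , refl with m≤n⇒∃[o]m+o≡n (≤-trans (s≤s (m≤n+m d t′)) (≤-pred t<k))
  ...     | e , d+e≡2m = ⊥-elim (1+n≢0 (begin
    1                            ≡⟨ alternates⇒pairSum≡1 alt e e<2m ⟨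
    pairSum (suc t′ + d + e)     ≡⟨ cong pairSum (rearrange t′ d e) ⟩
    pairSum (t′ + (suc d + e))   ≡⟨ cong (λ n → pairSum (t′ + n)) d+e≡2m ⟩
    pairSum (t′ + 2 * m)         ≡⟨ gap ⟩
    0                            ∎))
    where
    open ≡-Reasoning
    e<2m : e < 2 * m
    e<2m = subst (e <_) d+e≡2m (m<n+m e z<s)
    rearrange : ∀ t d e → suc t + d + e ≡ t + (suc d + e)
    rearrange = solve-∀

  alternates-unique : 1 ≤ m → ∀ {t t′} → AlternatesFrom t → t < k → t′ < k
    → b (t′ + 1) ≡ 1 → b (t′ + (2 * m ∸ 1)) ≡ 1 → t′ ≡ t
  alternates-unique 1≤m {t} {t′} alt t<k t′<k b[t′+1]≡1 b[t′+2m-1]≡1 =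
    pairSum≡0-unique alt t<k t′<k (cong₂ _+_ b[t′+2m]≡0 b[t′+k]≡0)
    where
    right-of-1 : ∀ {i} → b i ≡ 1 → b (suc i) ≡ 0
    right-of-1 {i} bi≡1 = n≤0⇒n≡0 (+-cancelˡ-≤ 1 _ 0 (subst (λ z → z + b (suc i) ≤ 1) bi≡1 (b-sparse i)))
    left-of-1 : ∀ {i} → b (suc i) ≡ 1 → b i ≡ 0
    left-of-1 {i} bsi≡1 = n≤0⇒n≡0 (+-cancelʳ-≤ 1 _ 0 (subst (λ z → b i + z ≤ 1) bsi≡1 (b-sparse i)))
    b[t′+2m]≡0 : b (t′ + 2 * m) ≡ 0
    b[t′+2m]≡0 = subst (λ n → b n ≡ 0)
      (trans (sym (+-suc t′ (2 * m ∸ 1))) (cong (t′ +_) (m+[n∸m]≡n (≤-trans 1≤m (m≤m+n m _)))))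
      (right-of-1 b[t′+2m-1]≡1)
    b[t′+k]≡0 : b (suc (t′ + 2 * m)) ≡ 0
    b[t′+k]≡0 = trans (cong b (sym (+-suc t′ (2 * m)))) (trans (b-periodic t′) (left-of-1 (trans (cong b (+-comm 1 t′)) b[t′+1]≡1)))

ρ^-+ : ∀ {k} a b (x : Word k) → ρ^ (a + b) x ≡ ρ^ a (ρ^ b x)
ρ^-+ zero b x = refl
ρ^-+ (suc a) b x = cong ρ (ρ^-+ a b x)

-- ρ^ k x ≡ x is proved through toList: on vectors, ρ^ n (xs ++ ys) and ys ++ xs have the lengths
-- n + m and m + n, which are not definitionally equal.
rotateList : List Bool → List Bool
rotateList [] = []
rotateList (a ∷ as) = as List.∷ʳ a

toList-ρ^ : ∀ {k} i (x : Word k) → toList (ρ^ i x) ≡ fold (toList x) rotateList i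
toList-ρ^ zero x = refl
toList-ρ^ (suc i) x = trans (toList-ρ (ρ^ i x)) (cong rotateList (toList-ρ^ i x))
  where
  toList-ρ : ∀ {k} (y : Word k) → toList (ρ y) ≡ rotateList (toList y)
  toList-ρ [] = refl
  toList-ρ (a ∷ as) = VP.toList-∷ʳ a as

fold-rotateList-++ : ∀ xs ys → fold (xs ++ ys) rotateList (length xs) ≡ ys ++ xs
fold-rotateList-++ [] ys = sym (++-identityʳ ys)
fold-rotateList-++ (a ∷ xs) ys = begin
  fold (a ∷ xs ++ ys) rotateList (suc (length xs))        ≡⟨ cong (fold (a ∷ xs ++ ys) rotateList) (+-comm 1 (length xs)) ⟩
  fold (a ∷ xs ++ ys) rotateList (length xs + 1)          ≡⟨ fold-+ (a ∷ xs ++ ys) rotateList (length xs) ⟩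
  fold ((xs ++ ys) List.∷ʳ a) rotateList (length xs)      ≡⟨ cong (λ zs → fold zs rotateList (length xs)) (++-assoc xs ys (a ∷ [])) ⟩
  fold (xs ++ (ys List.∷ʳ a)) rotateList (length xs)      ≡⟨ fold-rotateList-++ xs (ys List.∷ʳ a) ⟩
  (ys List.∷ʳ a) ++ xs                                     ≡⟨ ++-assoc ys (a ∷ []) xs ⟩
  ys ++ a ∷ xs                                             ∎
  where open ≡-Reasoning

ρ^-length : ∀ {k} (x : Word k) → ρ^ k x ≡ x
ρ^-length {k} x = trans (sym (VP.cast-is-id refl (ρ^ k x))) (VP.toList-injective refl (ρ^ k x) x (begin
  toList (ρ^ k x)                                          ≡⟨ toList-ρ^ k x ⟩
  fold (toList x) rotateList k
    ≡⟨ cong₂ (λ xs n → fold xs rotateList n) (++-identityʳ (toList x)) (VP.length-toList x) ⟨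
  fold (toList x ++ []) rotateList (length (toList x))     ≡⟨ fold-rotateList-++ (toList x) [] ⟩
  toList x                                                 ∎))
  where open ≡-Reasoning

ρ^-periodic : ∀ {k} (x : Word k) → Periodic k (λ i → ρ^ i x)
ρ^-periodic {k} x i = trans (ρ^-+ i k x) (cong (ρ^ i) (ρ^-length x))

ρ^-offset : ∀ {k} .{{_ : NonZero k}} (x : Word k) {t} → t ≤ k → ∀ i → ρ^ (t + (i + k ∸ t) % k) x ≡ ρ^ i x
ρ^-offset {k} x {t} t≤k i = begin
  ρ^ (t + (i + k ∸ t) % k) x       ≡⟨ ρ^-+ t _ x ⟩
  ρ^ t (ρ^ ((i + k ∸ t) % k) x)    ≡⟨ cong (ρ^ t) (periodic-% (ρ^-periodic x) (i + k ∸ t)) ⟩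
  ρ^ t (ρ^ (i + k ∸ t) x)          ≡⟨ ρ^-+ t _ x ⟨
  ρ^ (t + (i + k ∸ t)) x           ≡⟨ cong (λ n → ρ^ n x) (m+[n∸m]≡n (≤-trans t≤k (m≤n+m k i))) ⟩
  ρ^ (i + k) x                     ≡⟨ ρ^-periodic x i ⟩
  ρ^ i x                           ∎
  where open ≡-Reasoning

ρ-injective : ∀ {k} {x y : Word k} → ρ x ≡ ρ y → x ≡ y
ρ-injective {x = []} {[]} _ = refl
ρ-injective {x = a ∷ as} {b ∷ bs} eq with VP.∷ʳ-injective as bs eq
... | refl , refl = refl

ρ^-injective : ∀ {k} i {x y : Word k} → ρ^ i x ≡ ρ^ i y → x ≡ y
ρ^-injective zero eq = eq
ρ^-injective (suc i) eq = ρ^-injective i (ρ-injective eq)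

ρ-replicate : ∀ k (a : Bool) → ρ (replicate k a) ≡ replicate k a
ρ-replicate zero a = refl
ρ-replicate (suc k) a = ∷ʳ-replicate k
  where
  ∷ʳ-replicate : ∀ n → replicate n a ∷ʳ a ≡ a ∷ replicate n a
  ∷ʳ-replicate zero = refl
  ∷ʳ-replicate (suc n) = cong (a ∷_) (∷ʳ-replicate n)

ρ^-replicate : ∀ k i (a : Bool) → ρ^ i (replicate k a) ≡ replicate k a
ρ^-replicate k zero a = refl
ρ^-replicate k (suc i) a = trans (cong ρ (ρ^-replicate k i a)) (ρ-replicate k a)

ρ-fixed⇒replicate : ∀ {k} (y : Word k) → ρ y ≡ y → ∃[ a ] y ≡ replicate k a
ρ-fixed⇒replicate [] _ = false , refl
ρ-fixed⇒replicate (a ∷ as) eq = a , cong (a ∷_) (∷ʳ-fixed as eq)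
  where
  ∷ʳ-fixed : ∀ {n} (cs : Vec Bool n) → cs ∷ʳ a ≡ a ∷ cs → cs ≡ replicate n a
  ∷ʳ-fixed [] _ = refl
  ∷ʳ-fixed (c ∷ cs) eq with VP.∷-injective eq
  ... | refl , eq′ = cong (a ∷_) (∷ʳ-fixed cs eq′)

nonConstant⇒≢replicate : ∀ {k} {x : Word k} → NonConstant x → ∀ a → x ≢ replicate k a
nonConstant⇒≢replicate (x≢0s , _) false = x≢0s
nonConstant⇒≢replicate (_ , x≢1s) true = x≢1s

nonConstant-ρ^ : ∀ {k} {x : Word k} → NonConstant x → ∀ i → NonConstant (ρ^ i x)
nonConstant-ρ^ {k} nc i = not-replicate false , not-replicate true
  where
  not-replicate : ∀ a → ρ^ i _ ≢ replicate k a
  not-replicate a eq = nonConstant⇒≢replicate nc a (ρ^-injective i (trans eq (sym (ρ^-replicate k i a))))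

nonConstant⇒ρ≢ : ∀ {k} {y : Word k} → NonConstant y → ρ y ≢ y
nonConstant⇒ρ≢ {y = y} nc ρy≡y with ρ-fixed⇒replicate y ρy≡y
... | a , y≡aᵏ = nonConstant⇒≢replicate nc a y≡aᵏ

ρ^-*-fixed : ∀ {k} {y : Word k} {d} → ρ^ d y ≡ y → ∀ q → ρ^ (q * d) y ≡ y
ρ^-*-fixed fixed zero = refl
ρ^-*-fixed {y = y} {d} fixed (suc q) = trans (ρ^-+ d (q * d) y) (trans (cong (ρ^ d) (ρ^-*-fixed fixed q)) fixed)

coprime-periods⇒ρ-fixed : ∀ {k} {y : Word k} {a b} → Coprime a b → ρ^ a y ≡ y → ρ^ b y ≡ y → ρ y ≡ y
coprime-periods⇒ρ-fixed {y = y} a⊥b fixedᵃ fixedᵇ with coprime-Bézout a⊥b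
... | Bézout.+- u v 1+vb≡ua =
  trans (cong ρ (sym (ρ^-*-fixed fixedᵇ v))) (trans (cong (λ n → ρ^ n y) 1+vb≡ua) (ρ^-*-fixed fixedᵃ u))
... | Bézout.-+ u v 1+ua≡vb =
  trans (cong ρ (sym (ρ^-*-fixed fixedᵃ u))) (trans (cong (λ n → ρ^ n y) 1+ua≡vb) (ρ^-*-fixed fixedᵇ v))

ρ^-distinct : ∀ {k} → Prime k → {x : Word k} → NonConstant x → ∀ {i j} → i < j → j < k → ρ^ i x ≢ ρ^ j x
ρ^-distinct {k} k-prime {x} nc {i} {j} i<j j<k ρⁱx≡ρʲx =
  nonConstant⇒ρ≢ (nonConstant-ρ^ nc i) (coprime-periods⇒ρ-fixed d⊥k ρᵈy≡y (ρ^-length (ρ^ i x)))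
  where
  d = j ∸ i
  instance
    d≢0 : NonZero d
    d≢0 = >-nonZero (m<n⇒0<n∸m i<j)
  d⊥k : Coprime d k
  d⊥k = Coprime.sym (prime⇒coprime k-prime (≤-<-trans (m∸n≤m j i) j<k))
  ρᵈy≡y : ρ^ d (ρ^ i x) ≡ ρ^ i x
  ρᵈy≡y = sym (trans ρⁱx≡ρʲx (trans (cong (λ n → ρ^ n x) (sym (m∸n+n≡m (<⇒≤ i<j)))) (ρ^-+ d i x)))

Adj-ρ : ∀ {k} (y : Word k) → ρ y ≢ y → Adj y (ρ y)
Adj-ρ [] ρy≢y = ⊥-elim (ρy≢y refl)
Adj-ρ (a ∷ as) ρy≢y = ρy≢y ∘ sym , inj₁ (sym (prefix-∷ʳ as))
  where
  prefix-∷ʳ : ∀ {n} (cs : Vec Bool n) → prefix (cs ∷ʳ a) ≡ cs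
  prefix-∷ʳ [] = refl
  prefix-∷ʳ (c ∷ []) = refl
  prefix-∷ʳ (c ∷ d ∷ cs) = cong (c ∷_) (prefix-∷ʳ (d ∷ cs))

independent⇒𝟙+𝟙≤1 : ∀ {k} {S : Word k → Bool} → Independent S → ∀ {x y} → Adj x y → 𝟙 (S x) + 𝟙 (S y) ≤ 1
independent⇒𝟙+𝟙≤1 {S = S} indep {x} {y} adj with S x in Sx | S y in Sy
... | true | true = ⊥-elim (indep x y Sx Sy adj)
... | true | false = ≤-refl
... | false | _ = 𝟙≤1 _
  where
  𝟙≤1 : ∀ b → 𝟙 b ≤ 1
  𝟙≤1 true = ≤-refl
  𝟙≤1 false = z≤n

∈-allWords : ∀ {k} (w : Word k) → w ∈ allWords k
∈-allWords [] = here refl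
∈-allWords (false ∷ w) = ∈-++⁺ˡ (∈-map⁺ (false ∷_) (∈-allWords w))
∈-allWords {suc k} (true ∷ w) = ∈-++⁺ʳ (map (false ∷_) (allWords k)) (∈-map⁺ (true ∷_) (∈-allWords w))

length-allWords : ∀ k → length (allWords k) ≡ 2 ^ k
length-allWords zero = refl
length-allWords (suc k) = begin
  length (map (false ∷_) (allWords k) ++ map (true ∷_) (allWords k))   ≡⟨ length-++ (map (false ∷_) (allWords k)) ⟩
  length (map (false ∷_) (allWords k)) + length (map (true ∷_) (allWords k))
    ≡⟨ cong₂ _+_ (length-map (false ∷_) (allWords k)) (length-map (true ∷_) (allWords k)) ⟩
  length (allWords k) + length (allWords k)
    ≡⟨ cong₂ _+_ (length-allWords k) (trans (length-allWords k) (sym (+-identityʳ _))) ⟩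
  2 ^ k + (2 ^ k + 0)                                                  ∎
  where open ≡-Reasoning

∑-allWords-∷ : ∀ k (f : Word (suc k) → ℕ)
  → ∑ (allWords (suc k)) f ≡ ∑ (allWords k) (f ∘ (false ∷_)) + ∑ (allWords k) (f ∘ (true ∷_))
∑-allWords-∷ k f = trans (∑-++ (map (false ∷_) (allWords k)) _ f)
  (cong₂ _+_ (∑-map (false ∷_) (allWords k) f) (∑-map (true ∷_) (allWords k) f))

∑-allWords-∷ʳ : ∀ k (f : Word (suc k) → ℕ)
  → ∑ (allWords (suc k)) f ≡ ∑ (allWords k) (λ w → f (w ∷ʳ false)) + ∑ (allWords k) (λ w → f (w ∷ʳ true))
∑-allWords-∷ʳ zero f = cong (_+ (f (true ∷ []) + 0)) (sym (+-identityʳ (f (false ∷ []))))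
∑-allWords-∷ʳ (suc k) f = begin
  ∑ (allWords (suc (suc k))) f                                      ≡⟨ ∑-allWords-∷ (suc k) f ⟩
  ∑ (allWords (suc k)) (f ∘ (false ∷_)) + ∑ (allWords (suc k)) (f ∘ (true ∷_))
    ≡⟨ cong₂ _+_ (∑-allWords-∷ʳ k (f ∘ (false ∷_))) (∑-allWords-∷ʳ k (f ∘ (true ∷_))) ⟩
  (∑ʷ false false + ∑ʷ false true) + (∑ʷ true false + ∑ʷ true true) ≡⟨ interchange (∑ʷ false false) _ _ (∑ʷ true true) ⟩
  (∑ʷ false false + ∑ʷ true false) + (∑ʷ false true + ∑ʷ true true)
    ≡⟨ cong₂ _+_ (∑-allWords-∷ k (λ w → f (w ∷ʳ false))) (∑-allWords-∷ k (λ w → f (w ∷ʳ true))) ⟨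
  ∑ (allWords (suc k)) (λ w → f (w ∷ʳ false)) + ∑ (allWords (suc k)) (λ w → f (w ∷ʳ true)) ∎
  where
  open ≡-Reasoning
  ∑ʷ : Bool → Bool → ℕ
  ∑ʷ first last = ∑ (allWords k) (λ w → f (first ∷ (w ∷ʳ last)))

∑-allWords-ρ : ∀ k (f : Word k → ℕ) → ∑ (allWords k) (f ∘ ρ) ≡ ∑ (allWords k) f
∑-allWords-ρ zero f = refl
∑-allWords-ρ (suc k) f = trans (∑-allWords-∷ k (f ∘ ρ)) (sym (∑-allWords-∷ʳ k f))

∑-allWords-ρ^ : ∀ k i (f : Word k → ℕ) → ∑ (allWords k) (f ∘ ρ^ i) ≡ ∑ (allWords k) f
∑-allWords-ρ^ k zero f = refl
∑-allWords-ρ^ k (suc i) f = trans (∑-allWords-ρ^ k i (f ∘ ρ)) (∑-allWords-ρ k f)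

update : ∀ {k} → Word k → ℕ → (Word k → ℕ) → Word k → ℕ
update c v f w = if does (c ≟w w) then v else f w

update-≢ : ∀ {k} {c w : Word k} v f → c ≢ w → update c v f w ≡ f w
update-≢ {c = c} {w} v f c≢w = cong (if_then v else f w) (dec-false (c ≟w w) c≢w)

∑-allWords-update : ∀ k (c : Word k) v (f : Word k → ℕ) → ∑ (allWords k) (update c v f) + f c ≡ ∑ (allWords k) f + v
∑-allWords-update zero [] v f =
  trans (cong (_+ f []) (+-identityʳ v)) (trans (+-comm v (f [])) (cong (_+ v) (sym (+-identityʳ (f [])))))
∑-allWords-update (suc k) (false ∷ c) v f = begin
  ∑ (allWords (suc k)) (update (false ∷ c) v f) + f (false ∷ c)
    ≡⟨ cong (_+ f (false ∷ c)) (∑-allWords-∷ k (update (false ∷ c) v f)) ⟩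
  ∑ (allWords k) (update c v f₀) + ∑ (allWords k) f₁ + f₀ c
    ≡⟨ xy∙z≈xz∙y (∑ (allWords k) (update c v f₀)) (∑ (allWords k) f₁) (f₀ c) ⟩
  ∑ (allWords k) (update c v f₀) + f₀ c + ∑ (allWords k) f₁   ≡⟨ cong (_+ ∑ (allWords k) f₁) (∑-allWords-update k c v f₀) ⟩
  ∑ (allWords k) f₀ + v + ∑ (allWords k) f₁                   ≡⟨ xy∙z≈xz∙y (∑ (allWords k) f₀) v (∑ (allWords k) f₁) ⟩
  ∑ (allWords k) f₀ + ∑ (allWords k) f₁ + v                   ≡⟨ cong (_+ v) (∑-allWords-∷ k f) ⟨
  ∑ (allWords (suc k)) f + v                                  ∎
  where
  open ≡-Reasoning
  f₀ f₁ : Word k → ℕ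
  f₀ = f ∘ (false ∷_)
  f₁ = f ∘ (true ∷_)
∑-allWords-update (suc k) (true ∷ c) v f = begin
  ∑ (allWords (suc k)) (update (true ∷ c) v f) + f (true ∷ c)
    ≡⟨ cong (_+ f (true ∷ c)) (∑-allWords-∷ k (update (true ∷ c) v f)) ⟩
  ∑ (allWords k) f₀ + ∑ (allWords k) (update c v f₁) + f₁ c   ≡⟨ +-assoc (∑ (allWords k) f₀) _ (f₁ c) ⟩
  ∑ (allWords k) f₀ + (∑ (allWords k) (update c v f₁) + f₁ c) ≡⟨ cong (∑ (allWords k) f₀ +_) (∑-allWords-update k c v f₁) ⟩
  ∑ (allWords k) f₀ + (∑ (allWords k) f₁ + v)                 ≡⟨ +-assoc (∑ (allWords k) f₀) (∑ (allWords k) f₁) v ⟨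
  ∑ (allWords k) f₀ + ∑ (allWords k) f₁ + v                   ≡⟨ cong (_+ v) (∑-allWords-∷ k f) ⟨
  ∑ (allWords (suc k)) f + v                                  ∎
  where
  open ≡-Reasoning
  f₀ f₁ : Word k → ℕ
  f₀ = f ∘ (false ∷_)
  f₁ = f ∘ (true ∷_)

∑-allWords-δ : ∀ k (c : Word k) (f : Word k → ℕ) → ∑ (allWords k) (λ w → f w * 𝟙 (does (c ≟w w))) ≡ f c
∑-allWords-δ k c f = begin
  ∑ (allWords k) (λ w → f w * 𝟙 (does (c ≟w w)))   ≡⟨ ∑-cong (allWords k) δ≗update ⟩
  ∑ (allWords k) (update c (f c) (λ _ → 0))        ≡⟨ +-identityʳ (∑ (allWords k) (update c (f c) (λ _ → 0))) ⟨
  ∑ (allWords k) (update c (f c) (λ _ → 0)) + 0    ≡⟨ ∑-allWords-update k c (f c) (λ _ → 0) ⟩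
  ∑ (allWords k) (λ _ → 0) + f c                   ≡⟨ cong (_+ f c) (trans (∑-const (allWords k) 0) (*-zeroʳ (length (allWords k)))) ⟩
  f c                                              ∎
  where
  open ≡-Reasoning
  δ≗update : ∀ w → f w * 𝟙 (does (c ≟w w)) ≡ update c (f c) (λ _ → 0) w
  δ≗update w with c ≟w w
  ... | yes refl = *-identityʳ (f w)
  ... | no _ = *-zeroʳ (f w)

-- Counting S along rotation orbits

orbitCount : ∀ {k} → (Word k → Bool) → Word k → ℕ
orbitCount {k} S x = ∑ (upTo k) (λ i → 𝟙 (S (ρ^ i x)))

∑-orbitCount : ∀ {k} (S : Word k → Bool) → ∑ (allWords k) (orbitCount S) ≡ k * card S
∑-orbitCount {k} S = begin
  ∑ (allWords k) (orbitCount S)                                ≡⟨ ∑-comm (allWords k) (upTo k) (λ x i → 𝟙 (S (ρ^ i x))) ⟩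
  ∑ (upTo k) (λ i → ∑ (allWords k) (λ x → 𝟙 (S (ρ^ i x))))     ≡⟨ ∑-cong (upTo k) (λ i → ∑-allWords-ρ^ k i (𝟙 ∘ S)) ⟩
  ∑ (upTo k) (λ _ → ∑ (allWords k) (𝟙 ∘ S))                    ≡⟨ ∑-const (upTo k) _ ⟩
  length (upTo k) * ∑ (allWords k) (𝟙 ∘ S)                     ≡⟨ cong₂ _*_ (length-upTo k) (sym (countᵇ≡∑𝟙 S (allWords k))) ⟩
  k * card S                                                   ∎
  where open ≡-Reasoning

orbitCount-replicate : ∀ k (S : Word k → Bool) a → orbitCount S (replicate k a) ≡ k * 𝟙 (S (replicate k a))
orbitCount-replicate k S a = begin
  orbitCount S (replicate k a)                    ≡⟨ ∑-cong (upTo k) (λ i → cong (𝟙 ∘ S) (ρ^-replicate k i a)) ⟩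
  ∑ (upTo k) (λ _ → 𝟙 (S (replicate k a)))        ≡⟨ ∑-const (upTo k) _ ⟩
  length (upTo k) * 𝟙 (S (replicate k a))         ≡⟨ cong (_* 𝟙 (S (replicate k a))) (length-upTo k) ⟩
  k * 𝟙 (S (replicate k a))                       ∎
  where open ≡-Reasoning

cardInOrbit≡orbitCount : ∀ {k} → Prime k → (S : Word k → Bool) → ∀ {x} → NonConstant x → cardInOrbit S x ≡ orbitCount S x
cardInOrbit≡orbitCount {k} k-prime S {x} nc = begin
  cardInOrbit S x
    ≡⟨ countᵇ≡∑𝟙 _ (allWords k) ⟩
  ∑ (allWords k) (λ y → 𝟙 (S y ∧ inOrbitᵇ x y))
    ≡⟨ ∑-cong (allWords k) (λ y → trans (𝟙-∧ (S y) _) (cong (𝟙 (S y) *_) (𝟙-any≡∑𝟙 _ (at-most-one y)))) ⟩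
  ∑ (allWords k) (λ y → 𝟙 (S y) * ∑ (upTo k) (λ i → 𝟙 (does (ρ^ i x ≟w y))))
    ≡⟨ ∑-cong (allWords k) (λ y → *-distribˡ-∑ (𝟙 (S y)) (upTo k) _) ⟩
  ∑ (allWords k) (λ y → ∑ (upTo k) (λ i → 𝟙 (S y) * 𝟙 (does (ρ^ i x ≟w y))))
    ≡⟨ ∑-comm (allWords k) (upTo k) _ ⟩
  ∑ (upTo k) (λ i → ∑ (allWords k) (λ y → 𝟙 (S y) * 𝟙 (does (ρ^ i x ≟w y))))
    ≡⟨ ∑-cong (upTo k) (λ i → ∑-allWords-δ k (ρ^ i x) (𝟙 ∘ S)) ⟩
  orbitCount S x
    ∎
  where
  open ≡-Reasoning
  at-most-one : ∀ y → AllPairs (λ i j → T (does (ρ^ i x ≟w y)) → does (ρ^ j x ≟w y) ≡ false) (upTo k)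
  at-most-one y = AllPairs.applyUpTo⁺₁ id k unique
    where
    unique : ∀ {i j} → i < j → j < k → T (does (ρ^ i x ≟w y)) → does (ρ^ j x ≟w y) ≡ false
    unique {i} {j} i<j j<k with ρ^ i x ≟w y
    ... | yes ρⁱx≡y = λ _ → dec-false (ρ^ j x ≟w y) (λ ρʲx≡y → ρ^-distinct k-prime nc i<j j<k (trans ρⁱx≡y (sym ρʲx≡y)))
    ... | no _ = λ ()

J-odd : ∀ {k r} → J k r → r % 2 ≡ 1
J-odd (j , refl , _) = trans (cong (λ n → suc n % 2) (*-comm 2 j)) ([m+kn]%n≡m%n 1 j 2)

J-< : ∀ {m r} → J (suc (2 * m)) r → r < suc (2 * m)
J-< {m} (_ , _ , r≤2m∸1) = s≤s (≤-trans r≤2m∸1 (m∸n≤m (2 * m) 1))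

odd⇒J : ∀ {m r} → r < suc (2 * m) → r % 2 ≡ 1 → J (suc (2 * m)) r
odd⇒J {m} {r} r<k r%2≡1 = r / 2 , r≡1+2[r/2] , r≤2m∸1
  where
  r≡1+2[r/2] : r ≡ suc (2 * (r / 2))
  r≡1+2[r/2] = trans (m≡m%n+[m/n]*n r 2) (cong₂ _+_ r%2≡1 (*-comm (r / 2) 2))
  r≢2m : r ≢ 2 * m
  r≢2m r≡2m = 0≢1+n (trans (sym (trans (cong (_% 2) (*-comm 2 m)) (m*n%n≡0 m 2))) (trans (cong (_% 2) (sym r≡2m)) r%2≡1))
  r≤2m∸1 : r ≤ 2 * m ∸ 1
  r≤2m∸1 = subst (r ≤_) (pred[m∸n]≡m∸[1+n] (2 * m) 0) (<⇒≤pred (≤∧≢⇒< (≤-pred r<k) r≢2m))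

J-first : ∀ {m} → 1 ≤ m → J (suc (2 * m)) 1
J-first {m} 1≤m = odd⇒J {m} (s≤s (≤-trans 1≤m (m≤m+n m _))) refl

J-last : ∀ {m} → 1 ≤ m → J (suc (2 * m)) (2 * m ∸ 1)
J-last (s≤s {n = m′} z≤n) = m′ , +-suc m′ (m′ + 0) , ≤-refl

orbit-periodic : ∀ {k} (S : Word k → Bool) x → Periodic k (λ i → 𝟙 (S (ρ^ i x)))
orbit-periodic S x i = cong (𝟙 ∘ S) (ρ^-periodic x i)

orbit-sparse : ∀ {k} {S : Word k → Bool} → Independent S → ∀ {x} → NonConstant x
  → ∀ i → 𝟙 (S (ρ^ i x)) + 𝟙 (S (ρ^ (suc i) x)) ≤ 1
orbit-sparse indep {x} nc i = independent⇒𝟙+𝟙≤1 indep (Adj-ρ (ρ^ i x) (nonConstant⇒ρ≢ (nonConstant-ρ^ nc i)))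

module Orbit {m} {S : Word (suc (2 * m)) → Bool} (S-independent : Independent S)
             {x : Word (suc (2 * m))} (x-nonConstant : NonConstant x) where

  private
    k : ℕ
    k = suc (2 * m)

  open SparseCycle {m} (orbit-periodic S x) (orbit-sparse S-independent x-nonConstant) public

  S∩C⇔A : ∀ {t} → t < k → AlternatesFrom t → ∀ y → (S y ≡ true × InOrbit x y) ⇔ InA x t y
  S∩C⇔A {t} t<k alt y = mk⇔ to from
    where
    to : S y ≡ true × InOrbit x y → InA x t y
    to (Sy , i , _ , ρⁱx≡y) = r , odd⇒J {m} (m%n<n (i + k ∸ t) k) r%2≡1 , sym ρ^[t+r]x≡y
      where
      r = (i + k ∸ t) % k
      ρ^[t+r]x≡y : ρ^ (t + r) x ≡ y
      ρ^[t+r]x≡y = trans (ρ^-offset x (<⇒≤ t<k) i) ρⁱx≡y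
      r%2≡1 : r % 2 ≡ 1
      r%2≡1 = trans (sym (alt r (m%n<n (i + k ∸ t) k))) (trans (cong (𝟙 ∘ S) ρ^[t+r]x≡y) (cong 𝟙 Sy))
    from : InA x t y → S y ≡ true × InOrbit x y
    from (r , r∈J , y≡ρ^[t+r]x) =
      𝟙≡1⇒true (trans (cong (𝟙 ∘ S) y≡ρ^[t+r]x) (trans (alt r (J-< {m} r∈J)) (J-odd {k} r∈J))) ,
      (t + r) % k , m%n<n (t + r) k , trans (periodic-% (ρ^-periodic x) (t + r)) (sym y≡ρ^[t+r]x)

  S∩C⇔A-unique : 1 ≤ m → ∀ {t t′} → t < k → AlternatesFrom t → t′ < k
    → (∀ y → (S y ≡ true × InOrbit x y) ⇔ InA x t′ y) → t′ ≡ t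
  S∩C⇔A-unique 1≤m {t} {t′} t<k alt t′<k S∩C⇔A′ =
    alternates-unique 1≤m alt t<k t′<k (in-S 1 (J-first 1≤m)) (in-S _ (J-last 1≤m))
    where
    in-S : ∀ r → J k r → 𝟙 (S (ρ^ (t′ + r) x)) ≡ 1
    in-S r r∈J = cong 𝟙 (proj₁ (Equivalence.from (S∩C⇔A′ (ρ^ (t′ + r) x)) (r , r∈J , refl)))

  ∃!phase : 1 ≤ m → orbitCount S x ≡ m
    → Σ ℕ λ t → t < k
        × ((y : Word k) → ((S y ≡ true × InOrbit x y) ⇔ InA x t y))
        × ((t′ : ℕ) → t′ < k
             → ((y : Word k) → ((S y ≡ true × InOrbit x y) ⇔ InA x t′ y))
             → t′ ≡ t)
  ∃!phase 1≤m count≡m with ∑≡m⇒alternates count≡m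
  ... | t , t<k , alt = t , t<k , S∩C⇔A t<k alt , λ t′ t′<k S∩C⇔A′ → S∩C⇔A-unique 1≤m t<k alt t′<k S∩C⇔A′

module MaximalCount {m} {S : Word (suc (2 * m)) → Bool} (S-independent : Independent S) where

  private
    k : ℕ
    k = suc (2 * m)
    c₀ c₁ : Word k
    c₀ = replicate k false
    c₁ = replicate k true

  bound₁ bound : Word k → ℕ
  bound₁ = update c₁ (orbitCount S c₁) (λ _ → m)
  bound = update c₀ (orbitCount S c₀) bound₁

  orbitCount≤bound : ∀ w → orbitCount S w ≤ bound w
  orbitCount≤bound w with c₀ ≟w w | c₁ ≟w w
  ... | yes refl | _ = ≤-refl
  ... | no _ | yes refl = ≤-refl
  ... | no c₀≢w | no c₁≢w = Orbit.∑≤m S-independent (c₀≢w ∘ sym , c₁≢w ∘ sym)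

  -- Both totals are compared after adding m + m, which avoids the truncated subtraction in 2 ^ k ∸ 2.
  ∑-bound+2m : 𝟙 (S c₀) + 𝟙 (S c₁) ≡ 1 → ∑ (allWords k) bound + (m + m) ≡ 2 ^ k * m + k
  ∑-bound+2m one-constant = begin
    ∑ (allWords k) bound + (m + m)                          ≡⟨ +-assoc (∑ (allWords k) bound) m m ⟨
    ∑ (allWords k) bound + m + m                            ≡⟨ cong (_+ m) (∑-allWords-update k c₀ _ _) ⟩
    ∑ (allWords k) bound₁ + orbitCount S c₀ + m             ≡⟨ xy∙z≈xz∙y (∑ (allWords k) bound₁) (orbitCount S c₀) m ⟩
    ∑ (allWords k) bound₁ + m + orbitCount S c₀             ≡⟨ cong (_+ orbitCount S c₀) (∑-allWords-update k c₁ _ _) ⟩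
    ∑ (allWords k) (λ _ → m) + orbitCount S c₁ + orbitCount S c₀
      ≡⟨ cong₂ (λ a b → a + b + orbitCount S c₀) (∑-const (allWords k) m) (orbitCount-replicate k S true) ⟩
    length (allWords k) * m + k * 𝟙 (S c₁) + orbitCount S c₀
      ≡⟨ cong₂ (λ a b → a * m + k * 𝟙 (S c₁) + b) (length-allWords k) (orbitCount-replicate k S false) ⟩
    2 ^ k * m + k * 𝟙 (S c₁) + k * 𝟙 (S c₀)               ≡⟨ +-assoc (2 ^ k * m) _ _ ⟩
    2 ^ k * m + (k * 𝟙 (S c₁) + k * 𝟙 (S c₀))             ≡⟨ cong (2 ^ k * m +_) (*-distribˡ-+ k (𝟙 (S c₁)) (𝟙 (S c₀))) ⟨
    2 ^ k * m + k * (𝟙 (S c₁) + 𝟙 (S c₀))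
      ≡⟨ cong (λ n → 2 ^ k * m + k * n) (trans (+-comm (𝟙 (S c₁)) _) one-constant) ⟩
    2 ^ k * m + k * 1                                       ≡⟨ cong (2 ^ k * m +_) (*-identityʳ k) ⟩
    2 ^ k * m + k                                           ∎
    where open ≡-Reasoning

  ∑-orbitCount+2m : 2 * k * card S ≡ 2 * k + 2 * m * (2 ^ k ∸ 2)
    → ∑ (allWords k) (orbitCount S) + (m + m) ≡ 2 ^ k * m + k
  ∑-orbitCount+2m |S|≡ = begin
    ∑ (allWords k) (orbitCount S) + (m + m)    ≡⟨ cong (_+ (m + m)) (∑-orbitCount S) ⟩
    k * card S + (m + m)                       ≡⟨ cong (_+ (m + m)) k|S|≡ ⟩
    k + m * (2 ^ k ∸ 2) + (m + m)              ≡⟨ regroup k m (2 ^ k ∸ 2) ⟩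
    (2 ^ k ∸ 2 + 2) * m + k                    ≡⟨ cong (λ n → n * m + k) (m∸n+n≡m (*-monoʳ-≤ 2 (m^n>0 2 (2 * m)))) ⟩
    2 ^ k * m + k                              ∎
    where
    open ≡-Reasoning
    regroup : ∀ k m X → k + m * X + (m + m) ≡ (X + 2) * m + k
    regroup = solve-∀
    k|S|≡ : k * card S ≡ k + m * (2 ^ k ∸ 2)
    k|S|≡ = *-cancelˡ-≡ _ _ 2 (begin
      2 * (k * card S)                ≡⟨ *-assoc 2 k (card S) ⟨
      2 * k * card S                  ≡⟨ |S|≡ ⟩
      2 * k + 2 * m * (2 ^ k ∸ 2)     ≡⟨ cong (2 * k +_) (*-assoc 2 m (2 ^ k ∸ 2)) ⟩
      2 * k + 2 * (m * (2 ^ k ∸ 2))   ≡⟨ *-distribˡ-+ 2 k (m * (2 ^ k ∸ 2)) ⟨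
      2 * (k + m * (2 ^ k ∸ 2))       ∎)

  orbitCount≡m : 2 * k * card S ≡ 2 * k + 2 * m * (2 ^ k ∸ 2) → 𝟙 (S c₀) + 𝟙 (S c₁) ≡ 1
    → ∀ {x} → NonConstant x → orbitCount S x ≡ m
  orbitCount≡m |S|≡ one-constant {x} (x≢c₀ , x≢c₁) = trans
    (∑-mono-≤-≡⇒≡ {xs = allWords k} orbitCount≤bound
      (+-cancelʳ-≡ (m + m) _ _ (trans (∑-orbitCount+2m |S|≡) (sym (∑-bound+2m one-constant)))) (∈-allWords x))
    (trans (update-≢ (orbitCount S c₀) bound₁ (x≢c₀ ∘ sym)) (update-≢ (orbitCount S c₁) (λ _ → m) (x≢c₁ ∘ sym)))

odd-prime : ∀ {k} → Prime k → k ≢ 2 → ∃[ m ] (1 ≤ m × k ≡ suc (2 * m))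
odd-prime {k} k-prime k≢2 with k % 2 | m≡m%n+[m/n]*n k 2 | m%n<n k 2
... | 0 | k≡[k/2]*2 | _ with prime⇒irreducible k-prime (divides (k / 2) k≡[k/2]*2)
...   | inj₁ ()
...   | inj₂ 2≡k = ⊥-elim (k≢2 (sym 2≡k))
odd-prime k-prime k≢2 | suc (suc _) | _ | s≤s (s≤s ())
odd-prime {k} k-prime k≢2 | 1 | k≡1+[k/2]*2 | _ = k / 2 , 1≤k/2 , k≡1+2[k/2]
  where
  k≡1+2[k/2] : k ≡ suc (2 * (k / 2))
  k≡1+2[k/2] = trans k≡1+[k/2]*2 (cong suc (*-comm (k / 2) 2))
  1≤k/2 : 1 ≤ k / 2
  1≤k/2 = n≢0⇒n>0 (λ k/2≡0 → ¬prime[1] (subst Prime (trans k≡1+2[k/2] (cong (λ q → suc (2 * q)) k/2≡0)) k-prime))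

exactly-one⇒𝟙+𝟙≡1 : ∀ {a b} → (a ≡ true × b ≡ false) ⊎ (a ≡ false × b ≡ true) → 𝟙 a + 𝟙 b ≡ 1
exactly-one⇒𝟙+𝟙≡1 (inj₁ (refl , refl)) = refl
exactly-one⇒𝟙+𝟙≡1 (inj₂ (refl , refl)) = refl

proposition4p4 : (k : ℕ) → Prime k → k ≢ 2
    → (S : Word k → Bool) → Independent S
    → 2 * k * card S ≡ 2 * k + (k ∸ 1) * (2 ^ k ∸ 2)
    → ((S (constW k false) ≡ true × S (constW k true) ≡ false)
       ⊎ (S (constW k false) ≡ false × S (constW k true) ≡ true))
    → (x : Word k) → NonConstant x
    → (cardInOrbit S x ≡ (k ∸ 1) / 2)
      × (Σ ℕ λ t → t < k
           × ((y : Word k) → ((S y ≡ true × InOrbit x y) ⇔ InA x t y))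
           × ((t′ : ℕ) → t′ < k
                → ((y : Word k) → ((S y ≡ true × InOrbit x y) ⇔ InA x t′ y))
                → t′ ≡ t))
proposition4p4 k k-prime k≢2 S S-independent |S|≡ one-constant x x-nonConstant with odd-prime k-prime k≢2
... | m , 1≤m , refl =
  trans (cardInOrbit≡orbitCount k-prime S x-nonConstant) (trans count≡m (sym 2m/2≡m)) ,
  Orbit.∃!phase S-independent x-nonConstant 1≤m count≡m
  where
  count≡m : orbitCount S x ≡ m
  count≡m = MaximalCount.orbitCount≡m S-independent |S|≡ (exactly-one⇒𝟙+𝟙≡1 one-constant) x-nonConstant
  2m/2≡m : 2 * m / 2 ≡ m
  2m/2≡m = trans (cong (_/ 2) (*-comm 2 m)) (m*n/n≡m m 2)
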